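{- Let $T$ be a tree on $n$ vertices with diameter $4$ whose central vertex $u$ has at least three non-leaf neighbors. Let $v_1,\ldots,v_k$ be all neighbors of $u$, labeled so that $\deg(v_1)\leq\cdots\leq\deg(v_k)$. If $\deg(v_k)-\deg(v_1)\leq 1$ and $\deg(v_k)\geq 4$, then for the tree $T'$ obtained from $T$ by deleting two pendant vertices (leaves) adjacent to $v_k$ and attaching to $u$ a pendant path of length $2$ (two new vertices $x,y$ with edges $ux$ and $xy$), we have $\xi^{ac}(T)<\xi^{ac}(T')$.
   Context: A tree of diameter $4$ has a unique central vertex (the vertex of minimum eccentricity $\varepsilon(u)=\max_v d(u,v)$). A leaf/pendant vertex has degree $1$. $M(u)$ is the product of the degrees of all neighbors of $u$, and $\xi^{ac}(G)=\sum_{u\in V(G)}\frac{M(u)}{\varepsilon(u)}$. -}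

module Defs where

open import Data.Bool using (Bool; true; false; if_then_else_; _∧_; _∨_; T; not)
open import Data.Nat using (ℕ; zero; suc; _+_; _*_; _≤_; _⊔_)
open import Data.Fin using (Fin; _≟_)
open import Data.List using (List; []; _∷_; [_]; _++_; map; foldr; allFin; length)
open import Data.Nat.ListAction using (sum; product)
open import Data.Bool.ListAction using (any)
open import Data.List.Relation.Unary.Unique.Propositional using (Unique)
open import Data.Integer using (+_)
open import Data.Rational using (ℚ; 0ℚ) renaming (_+_ to _+ℚ_; _/_ to _/ℚ_)
open import Data.Product using (_×_; ∃-syntax)
open import Data.Unit using (⊤)
open import Data.Empty using (⊥)
open import Relation.Nullary using (¬_)
open import Relation.Nullary.Decidable using (⌊_⌋)
open import Relation.Binary.PropositionalEquality using (_≡_)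

Graph : ℕ → Set
Graph n = Fin n → Fin n → Bool

IsSimple : ∀ {n} → Graph n → Set
IsSimple {n} G = (∀ x y → G x y ≡ G y x) × (∀ x → G x x ≡ false)

eqF : ∀ {n} → Fin n → Fin n → Bool
eqF x y = ⌊ x ≟ y ⌋

deg : ∀ {n} → Graph n → Fin n → ℕ
deg {n} G v = sum (map (λ w → if G v w then 1 else 0) (allFin n))

M : ∀ {n} → Graph n → Fin n → ℕ
M {n} G v = product (map (λ w → if G v w then deg G w else 1) (allFin n))

reach : ∀ {n} → Graph n → ℕ → Fin n → Fin n → Bool
reach G zero v w = eqF v w
reach {n} G (suc k) v w = reach G k v w ∨ any (λ z → reach G k v z ∧ G z w) (allFin n)

search : (ℕ → Bool) → ℕ → ℕ → ℕ
search p k zero = k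
search p k (suc b) = if p k then k else search p (suc k) b

-- distance d(v,w): least k with w reachable from v within k steps
-- (searched in 0..n; for connected graphs this is the true distance)
dist : ∀ {n} → Graph n → Fin n → Fin n → ℕ
dist {n} G v w = search (λ k → reach G k v w) 0 n

maxL : List ℕ → ℕ
maxL = foldr _⊔_ 0

ecc : ∀ {n} → Graph n → Fin n → ℕ
ecc {n} G v = maxL (map (dist G v) (allFin n))

diam : ∀ {n} → Graph n → ℕ
diam {n} G = maxL (map (ecc G) (allFin n))

Connected : ∀ {n} → Graph n → Set
Connected G = ∀ v w → ∃[ k ] T (reach G k v w)

Chain : ∀ {n} → Graph n → List (Fin n) → Set
Chain G [] = ⊤
Chain G (x ∷ []) = ⊤
Chain G (x ∷ y ∷ r) = T (G x y) × Chain G (y ∷ r)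

IsCycle : ∀ {n} → Graph n → List (Fin n) → Set
IsCycle G [] = ⊥
IsCycle G (x ∷ r) = (3 ≤ length (x ∷ r)) × Unique (x ∷ r) × Chain G ((x ∷ r) ++ [ x ])

Acyclic : ∀ {n} → Graph n → Set
Acyclic G = ∀ c → ¬ IsCycle G c

IsTree : ∀ {n} → Graph n → Set
IsTree G = IsSimple G × Connected G × Acyclic G

-- M/ε as a rational (ε = 0 only for the one-vertex graph; then the term is 0)
frac : ℕ → ℕ → ℚ
frac m zero = 0ℚ
frac m (suc e) = (+ m) /ℚ (suc e)

xiac : ∀ {n} → Graph n → ℚ
xiac {n} G = foldr _+ℚ_ 0ℚ (map (λ v → frac (M G v) (ecc G v)) (allFin n))

isEdge : ∀ {n} → Fin n → Fin n → Fin n → Fin n → Bool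
isEdge p q x y = (eqF x p ∧ eqF y q) ∨ (eqF x q ∧ eqF y p)

-- The deleted leaves a, b are reused as the new vertices x := a, y := b of the
-- pendant path u–x–y (same vertex count, result isomorphic to the paper's T').
transform : ∀ {n} → Graph n → (u vk a b : Fin n) → Graph n
transform G u vk a b x y =
  if isEdge a vk x y ∨ isEdge b vk x y then false
  else (if isEdge u a x y ∨ isEdge a b x y then true else G x y)

-- In a tree of diameter 4 whose centre u has two non-leaf neighbours, every vertex other than u
-- is a neighbour of u or a leaf hanging from one: a longer walk out of u, prolonged backwards
-- through another branch of u, would be a path of length 5. So ε is at least 2, 3, 4 on u, its
-- neighbours and the remaining vertices, and ξ^{ac}(T) ≤ (1/12) Σ_w c(w) M(w) with c = 6, 4, 3 on
-- these classes. In T′ every vertex is still within two steps of u, so weights defined in the same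
-- way bound ξ^{ac}(T′) from below. Comparing M vertex by vertex, the weighted sum grows by
-- 4 + 8(deg u − 3) + 6(P − 2)(deg v_k − 4) > 0, where P ≥ 2 is the product of the degrees of the
-- neighbours of u other than v_k.

module Submission where

open import Algebra.Bundles using (CommutativeMonoid)
open import Data.Bool using (Bool; true; false; if_then_else_; T; _∨_; _∧_)
open import Data.Bool.Properties using (T?; T-≡; T-∨; T-∧; ∨-comm; ∧-comm)
open import Data.Empty using (⊥; ⊥-elim)
open import Data.Fin using (Fin; zero; suc; _≟_; punchIn)
open import Data.Fin.Properties using (any?; punchInᵢ≢i; injective⇒≤)
import Data.Integer as ℤ
import Data.Integer.Properties as ℤ
import Data.Integer.Tactic.RingSolver as ℤ-Solver
open import Data.List using (List; []; _∷_; [_]; _++_; length; lookup; map; tabulate; foldr; allFin)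
open import Data.List.Properties using (map-tabulate)
open import Data.List.Membership.Propositional using (_∈_; _∉_)
open import Data.List.Membership.Propositional.Properties using (∈-lookup; ∈-allFin)
import Data.List.Membership.DecPropositional as DecMembership
open import Data.List.Relation.Binary.Subset.Propositional using (_⊆_)
open import Data.List.Relation.Unary.All as All using (All; []; _∷_)
open import Data.List.Relation.Unary.All.Properties using (¬Any⇒All¬; anti-mono)
open import Data.List.Relation.Unary.AllPairs using ([]; _∷_)
open import Data.List.Relation.Unary.Any as Any using (here; there)
open import Data.List.Relation.Unary.Any.Properties using (any⁺; any⁻)
open import Data.List.Relation.Unary.Unique.Propositional using (Unique)
open import Data.Nat as ℕ using (ℕ; zero; suc; _+_; _*_; _≤_; s≤s; z≤n; _≤?_)
open import Data.Nat.Properties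
  using ( +-0-commutativeMonoid; *-1-commutativeMonoid; +-mono-≤; *-mono-≤; *-monoʳ-≤; *-identityʳ
        ; ≤-refl; ≤-trans; ≤∧≢⇒<; ≰⇒>; n≤1+n; m≤n⇒m≤1+n; +-identityʳ; +-comm; +-suc; <⇒≱
        ; m≤m⊔n; m≤n⊔m; ⊔-lub; m≤n⇒∃[o]m+o≡n; m<m+n; module ≤-Reasoning)
import Data.Nat.Properties as ℕ
open import Data.Nat.Tactic.RingSolver using (solve-∀)
open import Data.Product using (_×_; _,_; proj₁; proj₂; Σ-syntax; ∃-syntax)
open import Data.Rational using (ℚ; 0ℚ; _<_; toℚᵘ)
import Data.Rational as ℚ
open import Data.Rational.Properties
  using (toℚᵘ-cancel-≤; toℚᵘ-cancel-<; toℚᵘ-fromℚᵘ; toℚᵘ-injective; toℚᵘ-homo-+)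
import Data.Rational.Properties as ℚ
open import Data.Rational.Unnormalised as ℚᵘ using (mkℚᵘ; *≡*; *≤*; *<*)
import Data.Rational.Unnormalised.Properties as ℚᵘ
open import Data.Sum using (_⊎_; inj₁; inj₂)
open import Data.Unit using (⊤; tt)
open import Data.Vec.Functional as Vector using (Vector; updateAt; removeAt)
open import Data.Vec.Functional.Properties using (updateAt-updates; updateAt-minimal)
open import Function using (id; const; _∘_; Injective)
open import Function.Bundles using (Equivalence)
open import Relation.Binary.PropositionalEquality
  using (_≡_; _≢_; ≢-sym; refl; sym; trans; cong; cong₂; subst; subst₂; module ≡-Reasoning)
open import Relation.Nullary using (¬_; yes; no)
open import Relation.Nullary.Decidable using (toWitness; decidable-stable; ¬?; _×-dec_)

open import Defs

eqF-refl : ∀ {n} (x : Fin n) → eqF x x ≡ true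
eqF-refl x with x ≟ x
... | yes _ = refl
... | no x≢x = ⊥-elim (x≢x refl)

eqF-≢ : ∀ {n} {x y : Fin n} → x ≢ y → eqF x y ≡ false
eqF-≢ {x = x} {y} x≢y with x ≟ y
... | yes x≡y = ⊥-elim (x≢y x≡y)
... | no _ = refl

≡true⇒T : ∀ {b} → b ≡ true → T b
≡true⇒T = Equivalence.from T-≡

≡false⇒¬T : ∀ {b} → b ≡ false → ¬ T b
≡false⇒¬T refl ()

T⇒≡true : ∀ {b} → T b → b ≡ true
T⇒≡true = Equivalence.to T-≡

¬T⇒≡false : ∀ {b} → ¬ T b → b ≡ false
¬T⇒≡false {false} _  = refl
¬T⇒≡false {true}  ¬b = ⊥-elim (¬b tt)

ι : Bool → ℕ
ι b = if b then 1 else 0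

if-T : ∀ {A : Set} {b} {p q : A} → T b → (if b then p else q) ≡ p
if-T {b = true} _ = refl

if-¬T : ∀ {A : Set} {b} {p q : A} → ¬ T b → (if b then p else q) ≡ q
if-¬T {b = true}  ¬b = ⊥-elim (¬b tt)
if-¬T {b = false} _  = refl

-- Finite sums and products

module MonoidSum {c ℓ} (𝕄 : CommutativeMonoid c ℓ) where

  open CommutativeMonoid 𝕄
    using (_≈_; _∙_; ε; ∙-congˡ; identityˡ; identityʳ; setoid; reflexive)
    renaming (Carrier to A; trans to ≈-trans)
  open import Algebra.Properties.CommutativeMonoid.Sum 𝕄
    using (sum; sum-remove; sum-cong-≗; sum-cong-≋; sum-replicate-zero)
  open import Relation.Binary.Reasoning.Setoid setoid

  _[_]≔ε : ∀ {n} → Vector A n → Fin n → Vector A n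
  f [ i ]≔ε = updateAt f i (const ε)

  []≔ε-≈ε : ∀ {n} {f : Vector A n} i j → (j ≢ i → f j ≈ ε) → (f [ i ]≔ε) j ≈ ε
  []≔ε-≈ε {f = f} i j f≈ε with j ≟ i
  ... | yes refl = reflexive (updateAt-updates i f)
  ... | no j≢i   = ≈-trans (reflexive (updateAt-minimal j i f j≢i)) (f≈ε j≢i)

  []≔ε-cong : ∀ {n} {f g : Vector A n} i j → (j ≢ i → f j ≈ g j) → (f [ i ]≔ε) j ≈ (g [ i ]≔ε) j
  []≔ε-cong {f = f} {g} i j f≈g with j ≟ i
  ... | yes refl = reflexive (trans (updateAt-updates i f) (sym (updateAt-updates i g)))
  ... | no j≢i   = begin
    (f [ i ]≔ε) j ≡⟨ updateAt-minimal j i f j≢i ⟩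
    f j           ≈⟨ f≈g j≢i ⟩
    g j           ≡⟨ updateAt-minimal j i g j≢i ⟨
    (g [ i ]≔ε) j ∎

  sum-[]≔ε : ∀ {n} (f : Vector A n) i → sum f ≈ f i ∙ sum (f [ i ]≔ε)
  sum-[]≔ε {suc n} f i = begin
    sum f                      ≈⟨ sum-remove {i = i} f ⟩
    f i ∙ sum (removeAt f i)   ≡⟨ cong (f i ∙_) (sum-cong-≗ removeAt-[]≔ε) ⟨
    f i ∙ sum f′               ≈⟨ ∙-congˡ (identityˡ _) ⟨
    f i ∙ (ε ∙ sum f′)         ≡⟨ cong (λ x → f i ∙ (x ∙ sum f′)) (updateAt-updates i f) ⟨
    f i ∙ ((f [ i ]≔ε) i ∙ sum f′) ≈⟨ ∙-congˡ (sum-remove {i = i} (f [ i ]≔ε)) ⟨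
    f i ∙ sum (f [ i ]≔ε)      ∎
    where
    f′ : Vector A n
    f′ = removeAt (f [ i ]≔ε) i
    removeAt-[]≔ε : ∀ j → f′ j ≡ removeAt f i j
    removeAt-[]≔ε j = updateAt-minimal (punchIn i j) i f (punchInᵢ≢i i j)

  sum-[]≔ε₂ : ∀ {n} (f : Vector A n) i j → i ≢ j → sum f ≈ f i ∙ (f j ∙ sum (f [ i ]≔ε [ j ]≔ε))
  sum-[]≔ε₂ f i j i≢j = begin
    sum f                                          ≈⟨ sum-[]≔ε f i ⟩
    f i ∙ sum (f [ i ]≔ε)                          ≈⟨ ∙-congˡ (sum-[]≔ε (f [ i ]≔ε) j) ⟩
    f i ∙ ((f [ i ]≔ε) j ∙ sum f″)                 ≡⟨ cong (λ x → f i ∙ (x ∙ sum f″)) (updateAt-minimal j i f (i≢j ∘ sym)) ⟩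
    f i ∙ (f j ∙ sum f″)                           ∎
    where
    f″ : Vector A _
    f″ = f [ i ]≔ε [ j ]≔ε

  sum-[]≔ε-cong : ∀ {n} {f g : Vector A n} i → (∀ j → j ≢ i → f j ≈ g j) →
                  sum (f [ i ]≔ε) ≈ sum (g [ i ]≔ε)
  sum-[]≔ε-cong i f≈g = sum-cong-≋ (λ j → []≔ε-cong i j (f≈g j))

  sum-[]≔ε₂-cong : ∀ {n} {f g : Vector A n} i j → (∀ k → k ≢ i → k ≢ j → f k ≈ g k) →
                   sum (f [ i ]≔ε [ j ]≔ε) ≈ sum (g [ i ]≔ε [ j ]≔ε)
  sum-[]≔ε₂-cong i j f≈g = sum-[]≔ε-cong j (λ k k≢j → []≔ε-cong i k (λ k≢i → f≈g k k≢i k≢j))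

  sum-single : ∀ {n} (f : Vector A n) i → (∀ j → j ≢ i → f j ≈ ε) → sum f ≈ f i
  sum-single {n} f i f≈ε = begin
    sum f                            ≈⟨ sum-[]≔ε f i ⟩
    f i ∙ sum (f [ i ]≔ε)            ≈⟨ ∙-congˡ (sum-cong-≋ (λ j → []≔ε-≈ε i j (f≈ε j))) ⟩
    f i ∙ sum (Vector.replicate n ε) ≈⟨ ∙-congˡ (sum-replicate-zero n) ⟩
    f i ∙ ε                          ≈⟨ identityʳ (f i) ⟩
    f i                              ∎

  sum-pair : ∀ {n} (f : Vector A n) i j → i ≢ j → (∀ k → k ≢ i → k ≢ j → f k ≈ ε) → sum f ≈ f i ∙ f j
  sum-pair f i j i≢j f≈ε = begin
    sum f                 ≈⟨ sum-[]≔ε f i ⟩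
    f i ∙ sum (f [ i ]≔ε) ≈⟨ ∙-congˡ (sum-single (f [ i ]≔ε) j rest≈ε) ⟩
    f i ∙ (f [ i ]≔ε) j   ≡⟨ cong (f i ∙_) (updateAt-minimal j i f (i≢j ∘ sym)) ⟩
    f i ∙ f j             ∎
    where
    rest≈ε : ∀ k → k ≢ j → (f [ i ]≔ε) k ≈ ε
    rest≈ε k k≢j = []≔ε-≈ε i k (λ k≢i → f≈ε k k≢i k≢j)

open import Algebra.Properties.Semiring.Sum ℕ.+-*-semiring
  using (∑-distrib-+; *-distribˡ-sum) renaming (sum-cong-≗ to ∑-cong)

∑ : ∀ {n} → Vector ℕ n → ℕ
∑ = Vector.foldr _+_ 0

∏ : ∀ {n} → Vector ℕ n → ℕ
∏ = Vector.foldr _*_ 1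

open MonoidSum +-0-commutativeMonoid
  using ()
  renaming ( _[_]≔ε to _[_]≔0; sum-[]≔ε to ∑-[]≔0; sum-[]≔ε₂ to ∑-[]≔0₂; sum-[]≔ε-cong to ∑-[]≔0-cong
           ; sum-[]≔ε₂-cong to ∑-[]≔0₂-cong; sum-single to ∑-single; sum-pair to ∑-pair)
open MonoidSum *-1-commutativeMonoid
  using ()
  renaming ( _[_]≔ε to _[_]≔1; sum-[]≔ε to ∏-[]≔1; sum-[]≔ε₂ to ∏-[]≔1₂
           ; sum-[]≔ε₂-cong to ∏-[]≔1₂-cong; sum-single to ∏-single; sum-pair to ∏-pair)

∑-≥-length : ∀ {n} (f : Vector ℕ n) {is} → Unique is → All (λ i → 1 ≤ f i) is → length is ≤ ∑ f
∑-≥-length f {[]}     _            _           = z≤n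
∑-≥-length f {i ∷ is} (i∉is ∷ is!) (1≤fi ∷ 1≤f) = begin
  suc (length is)     ≤⟨ +-mono-≤ 1≤fi (∑-≥-length (f [ i ]≔0) is! (All.zipWith unchanged (i∉is , 1≤f))) ⟩
  f i + ∑ (f [ i ]≔0) ≡⟨ ∑-[]≔0 f i ⟨
  ∑ f                 ∎
  where
  open ≤-Reasoning
  unchanged : ∀ {j} → i ≢ j × 1 ≤ f j → 1 ≤ (f [ i ]≔0) j
  unchanged {j} (i≢j , 1≤fj) = subst (1 ≤_) (sym (updateAt-minimal j i f (i≢j ∘ sym))) 1≤fj

∏-≥-1 : ∀ {n} (f : Vector ℕ n) → (∀ i → 1 ≤ f i) → 1 ≤ ∏ f
∏-≥-1 {zero}  f 1≤f = ≤-refl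
∏-≥-1 {suc n} f 1≤f = *-mono-≤ (1≤f zero) (∏-≥-1 (f ∘ suc) (1≤f ∘ suc))

[]≔1-≥1 : ∀ {n} {f : Vector ℕ n} i → (∀ j → 1 ≤ f j) → ∀ j → 1 ≤ (f [ i ]≔1) j
[]≔1-≥1 {f = f} i 1≤f j with j ≟ i
... | yes refl = subst (1 ≤_) (sym (updateAt-updates i f)) ≤-refl
... | no j≢i   = subst (1 ≤_) (sym (updateAt-minimal j i f j≢i)) (1≤f j)

∏-≥-factor : ∀ {n} (f : Vector ℕ n) i → (∀ j → 1 ≤ f j) → f i ≤ ∏ f
∏-≥-factor f i 1≤f = begin
  f i                 ≡⟨ *-identityʳ (f i) ⟨
  f i * 1             ≤⟨ *-monoʳ-≤ (f i) (∏-≥-1 (f [ i ]≔1) ([]≔1-≥1 i 1≤f)) ⟩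
  f i * ∏ (f [ i ]≔1) ≡⟨ ∏-[]≔1 f i ⟨
  ∏ f                 ∎
  where open ≤-Reasoning

δ : ∀ {n} → Fin n → ℕ → Vector ℕ n
δ i c j = if eqF j i then c else 0

δ-same : ∀ {n} (i : Fin n) {c} → δ i c i ≡ c
δ-same i rewrite eqF-refl i = refl

δ-other : ∀ {n} {i j : Fin n} {c} → j ≢ i → δ i c j ≡ 0
δ-other j≢i rewrite eqF-≢ j≢i = refl

∑-δ : ∀ {n} (i : Fin n) c → ∑ (δ i c) ≡ c
∑-δ i c = trans (∑-single (δ i c) i (λ j → δ-other)) (δ-same i)

∑-+δ : ∀ {n} (f : Vector ℕ n) i c → ∑ (λ w → f w + δ i c w) ≡ ∑ f + c
∑-+δ f i c = trans (∑-distrib-+ f (δ i c)) (cong (∑ f +_) (∑-δ i c))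

∑-+δ₃ : ∀ {n} c (f : Vector ℕ n) i₁ c₁ i₂ c₂ i₃ c₃ →
        ∑ (λ w → c * f w + δ i₁ c₁ w + δ i₂ c₂ w + δ i₃ c₃ w) ≡ c * ∑ f + c₁ + c₂ + c₃
∑-+δ₃ c f i₁ c₁ i₂ c₂ i₃ c₃ = begin
  ∑ (λ w → c * f w + δ i₁ c₁ w + δ i₂ c₂ w + δ i₃ c₃ w) ≡⟨ ∑-+δ (λ w → c * f w + δ i₁ c₁ w + δ i₂ c₂ w) i₃ c₃ ⟩
  ∑ (λ w → c * f w + δ i₁ c₁ w + δ i₂ c₂ w) + c₃         ≡⟨ cong (_+ c₃) (∑-+δ (λ w → c * f w + δ i₁ c₁ w) i₂ c₂) ⟩
  ∑ (λ w → c * f w + δ i₁ c₁ w) + c₂ + c₃               ≡⟨ cong (λ s → s + c₂ + c₃) (∑-+δ (λ w → c * f w) i₁ c₁) ⟩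
  ∑ (λ w → c * f w) + c₁ + c₂ + c₃                     ≡⟨ cong (λ s → s + c₁ + c₂ + c₃) (*-distribˡ-sum c f) ⟨
  c * ∑ f + c₁ + c₂ + c₃                               ∎
  where open ≡-Reasoning

∑-compensate : ∀ {n} (f g h k : Vector ℕ n) → (∀ i → f i + h i ≡ g i + k i) →
               ∑ k ℕ.< ∑ h → ∑ f ℕ.< ∑ g
∑-compensate f g h k balanced ∑k<∑h = ℕ.+-cancelʳ-< (∑ h) (∑ f) (∑ g) (begin-strict
  ∑ f + ∑ h           ≡⟨ ∑-distrib-+ f h ⟨
  ∑ (λ i → f i + h i) ≡⟨ ∑-cong balanced ⟩
  ∑ (λ i → g i + k i) ≡⟨ ∑-distrib-+ g k ⟩
  ∑ g + ∑ k           <⟨ ℕ.+-monoʳ-< (∑ g) ∑k<∑h ⟩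
  ∑ g + ∑ h           ∎)
  where open ≤-Reasoning

-- Rationals m / e

frac-≤ : ∀ m e m′ e′ → m * suc e′ ≤ m′ * suc e → frac m (suc e) ℚ.≤ frac m′ (suc e′)
frac-≤ m e m′ e′ h = toℚᵘ-cancel-≤
  (ℚᵘ.≤-respʳ-≃ (ℚᵘ.≃-sym (toℚᵘ-fromℚᵘ (mkℚᵘ (ℤ.+ m′) e′)))
  (ℚᵘ.≤-respˡ-≃ (ℚᵘ.≃-sym (toℚᵘ-fromℚᵘ (mkℚᵘ (ℤ.+ m) e)))
    (*≤* (subst₂ ℤ._≤_ (ℤ.pos-* m (suc e′)) (ℤ.pos-* m′ (suc e)) (ℤ.+≤+ h)))))

frac-< : ∀ m m′ e → m ℕ.< m′ → frac m (suc e) < frac m′ (suc e)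
frac-< m m′ e h = toℚᵘ-cancel-<
  (ℚᵘ.<-respʳ-≃ (ℚᵘ.≃-sym (toℚᵘ-fromℚᵘ (mkℚᵘ (ℤ.+ m′) e)))
  (ℚᵘ.<-respˡ-≃ (ℚᵘ.≃-sym (toℚᵘ-fromℚᵘ (mkℚᵘ (ℤ.+ m) e)))
    (*<* (subst₂ ℤ._<_ (ℤ.pos-* m (suc e)) (ℤ.pos-* m′ (suc e)) (ℤ.+<+ (ℕ.*-monoˡ-< (suc e) h))))))

frac-zero : ∀ e → frac 0 (suc e) ≡ 0ℚ
frac-zero e = toℚᵘ-injective (ℚᵘ.≃-trans (toℚᵘ-fromℚᵘ (mkℚᵘ (ℤ.+ 0) e)) (*≡* refl))

frac-+ : ∀ m m′ e → frac m (suc e) ℚ.+ frac m′ (suc e) ≡ frac (m + m′) (suc e)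
frac-+ m m′ e = toℚᵘ-injective (begin
  toℚᵘ (frac m (suc e) ℚ.+ frac m′ (suc e))          ≈⟨ toℚᵘ-homo-+ (frac m (suc e)) (frac m′ (suc e)) ⟩
  toℚᵘ (frac m (suc e)) ℚᵘ.+ toℚᵘ (frac m′ (suc e))  ≈⟨ ℚᵘ.+-cong (toℚᵘ-fromℚᵘ (mkℚᵘ (ℤ.+ m) e))
                                                                 (toℚᵘ-fromℚᵘ (mkℚᵘ (ℤ.+ m′) e)) ⟩
  mkℚᵘ (ℤ.+ m) e ℚᵘ.+ mkℚᵘ (ℤ.+ m′) e                ≈⟨ *≡* (common-denominator (ℤ.+ m) (ℤ.+ m′) (ℤ.+ suc e)) ⟩
  mkℚᵘ (ℤ.+ (m + m′)) e                              ≈⟨ toℚᵘ-fromℚᵘ (mkℚᵘ (ℤ.+ (m + m′)) e) ⟨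
  toℚᵘ (frac (m + m′) (suc e))                       ∎)
  where
  open ℚᵘ.≃-Reasoning
  common-denominator : ∀ a b d → (a ℤ.* d ℤ.+ b ℤ.* d) ℤ.* d ≡ (a ℤ.+ b) ℤ.* (d ℤ.* d)
  common-denominator = ℤ-Solver.solve-∀

frac-≤-rescale : ∀ m c e d → suc d ≤ c * e → frac m e ℚ.≤ frac (m * c) (suc d)
frac-≤-rescale m c zero    d d<c*0 with () ← subst (suc d ≤_) (ℕ.*-zeroʳ c) d<c*0
frac-≤-rescale m c (suc e) d d<c*e = frac-≤ m e (m * c) d (begin
  m * suc d       ≤⟨ *-monoʳ-≤ m d<c*e ⟩
  m * (c * suc e) ≡⟨ ℕ.*-assoc m c (suc e) ⟨
  m * c * suc e   ∎)
  where open ≤-Reasoning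

frac-≥-rescale : ∀ m c e d → 1 ≤ e → c * e ≤ suc d → frac (m * c) (suc d) ℚ.≤ frac m e
frac-≥-rescale m c (suc e) d _ c*e≤d = frac-≤ (m * c) d m e (begin
  m * c * suc e   ≡⟨ ℕ.*-assoc m c (suc e) ⟩
  m * (c * suc e) ≤⟨ *-monoʳ-≤ m c*e≤d ⟩
  m * suc d       ∎)
  where open ≤-Reasoning

∑ℚ : ∀ {n} → Vector ℚ n → ℚ
∑ℚ = Vector.foldr ℚ._+_ 0ℚ

∑ℚ-mono-≤ : ∀ {n} {f g : Vector ℚ n} → (∀ i → f i ℚ.≤ g i) → ∑ℚ f ℚ.≤ ∑ℚ g
∑ℚ-mono-≤ {zero}  f≤g = ℚ.≤-refl
∑ℚ-mono-≤ {suc n} f≤g = ℚ.+-mono-≤ (f≤g zero) (∑ℚ-mono-≤ (f≤g ∘ suc))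

∑ℚ-frac : ∀ {n} (f : Vector ℕ n) d → ∑ℚ (λ i → frac (f i) (suc d)) ≡ frac (∑ f) (suc d)
∑ℚ-frac {zero}  f d = sym (frac-zero d)
∑ℚ-frac {suc n} f d =
  trans (cong (frac (f zero) (suc d) ℚ.+_) (∑ℚ-frac (f ∘ suc) d)) (frac-+ (f zero) (∑ (f ∘ suc)) d)

-- Walks and distances

unique⇒lookup-injective : ∀ {A : Set} {xs : List A} → Unique xs → Injective _≡_ _≡_ (lookup xs)
unique⇒lookup-injective (x∉xs ∷ _) {zero}  {zero}  _  = refl
unique⇒lookup-injective (x∉xs ∷ _) {zero}  {suc j} eq = ⊥-elim (All.lookup x∉xs (∈-lookup j) eq)
unique⇒lookup-injective (x∉xs ∷ _) {suc i} {zero}  eq = ⊥-elim (All.lookup x∉xs (∈-lookup i) (sym eq))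
unique⇒lookup-injective (_ ∷ xs!) {suc i} {suc j} eq = cong suc (unique⇒lookup-injective xs! eq)

unique-length-≤ : ∀ {n} {xs : List (Fin n)} → Unique xs → length xs ≤ n
unique-length-≤ xs! = injective⇒≤ (unique⇒lookup-injective xs!)

maxL-≥ : ∀ {A : Set} (f : A → ℕ) {xs x} → x ∈ xs → f x ≤ maxL (map f xs)
maxL-≥ f {y ∷ xs} (here refl) = m≤m⊔n (f y) _
maxL-≥ f {y ∷ xs} (there x∈)  = ≤-trans (maxL-≥ f x∈) (m≤n⊔m (f y) _)

maxL-≤ : ∀ {A : Set} (f : A → ℕ) xs {k} → (∀ x → f x ≤ k) → maxL (map f xs) ≤ k
maxL-≤ f []       f≤k = z≤n
maxL-≤ f (x ∷ xs) f≤k = ⊔-lub (f≤k x) (maxL-≤ f xs f≤k)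

search-≤ : ∀ (p : ℕ → Bool) s b k → T (p k) → s ≤ k → search p s b ≤ k
search-≤ p s zero k pk s≤k = s≤k
search-≤ p s (suc b) k pk s≤k with p s in ps
... | true = s≤k
... | false = search-≤ p (suc s) b k pk (≤∧≢⇒< s≤k λ { refl → subst T ps pk })

search-≥ : ∀ (p : ℕ → Bool) s b L → (∀ j → j ℕ.< L → ¬ T (p j)) → L ≤ s + b → L ≤ search p s b
search-≥ p s zero L ¬p L≤s+b = subst (L ≤_) (+-identityʳ s) L≤s+b
search-≥ p s (suc b) L ¬p L≤s+b with p s in ps
... | false = search-≥ p (suc s) b L ¬p (subst (L ≤_) (+-suc s b) L≤s+b)
... | true with L ≤? s
...   | yes L≤s = L≤s
...   | no L≰s = ⊥-elim (¬p s (≰⇒> L≰s) (subst T (sym ps) tt))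

module Walks {n} (G : Graph n) where

  infixr 5 _∷_

  data Walk : Fin n → Fin n → Set where
    []  : ∀ {x} → Walk x x
    _∷_ : ∀ {x y z} → T (G x y) → Walk y z → Walk x z

  steps : ∀ {x y} → Walk x y → ℕ
  steps []      = 0
  steps (_ ∷ w) = suc (steps w)

  vertices : ∀ {x y} → Walk x y → List (Fin n)
  after : ∀ {x y} → Walk x y → List (Fin n)

  vertices {x} w = x ∷ after w
  after []      = []
  after (_ ∷ w) = vertices w

  _++ʷ_ : ∀ {x y z} → Walk x y → Walk y z → Walk x z
  []      ++ʷ v = v
  (e ∷ w) ++ʷ v = e ∷ (w ++ʷ v)

  steps-++ʷ : ∀ {x y z} (w : Walk x y) (v : Walk y z) → steps (w ++ʷ v) ≡ steps w + steps v
  steps-++ʷ []      v = refl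
  steps-++ʷ (_ ∷ w) v = cong suc (steps-++ʷ w v)

  last∈ : ∀ {x y} (w : Walk x y) → y ∈ vertices w
  last∈ []      = here refl
  last∈ (_ ∷ w) = there (last∈ w)

  reach-snoc : ∀ {k x y z} → T (reach G k x y) → T (G y z) → T (reach G (suc k) x z)
  reach-snoc {k} {x} {y} {z} r e = Equivalence.from (T-∨ {reach G k x z})
    (inj₂ (any⁺ _ (Any.map (λ { refl → Equivalence.from T-∧ (r , e) }) (∈-allFin y))))

  reach-along : ∀ {k x y z} → T (reach G k x y) → (w : Walk y z) → T (reach G (k + steps w) x z)
  reach-along {k} {x} {y} r [] = subst (λ j → T (reach G j x y)) (sym (+-identityʳ k)) r
  reach-along {k} {x} {z = z} r (e ∷ w) =
    subst (λ j → T (reach G j x z)) (sym (+-suc k (steps w))) (reach-along {suc k} (reach-snoc {k} r e) w)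

  walk⇒reach : ∀ {x y} (w : Walk x y) → T (reach G (steps w) x y)
  walk⇒reach {x} = reach-along {0} (subst T (sym (eqF-refl x)) tt)

  reach⇒walk : ∀ k {x y} → T (reach G k x y) → Σ[ w ∈ Walk x y ] steps w ≤ k
  reach⇒walk zero {x} r with toWitness {a? = x ≟ _} r
  ... | refl = [] , z≤n
  reach⇒walk (suc k) {x} {y} r with Equivalence.to (T-∨ {reach G k x y}) r
  ... | inj₁ r′ = let w , w≤k = reach⇒walk k r′ in w , m≤n⇒m≤1+n w≤k
  ... | inj₂ r″ with Any.satisfied (any⁻ _ (allFin n) r″)
  ...   | v , rv∧e with Equivalence.to T-∧ rv∧e
  ...     | rv , e = let w , w≤k = reach⇒walk k rv in
    w ++ʷ (e ∷ []) , subst (_≤ suc k) (sym (trans (steps-++ʷ w (e ∷ [])) (+-comm (steps w) 1))) (s≤s w≤k)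

  dist-≤ : ∀ {x y} (w : Walk x y) → dist G x y ≤ steps w
  dist-≤ {x} {y} w = search-≤ (λ j → reach G j x y) 0 n (steps w) (walk⇒reach w) z≤n

  dist-≥-1 : ∀ {x y} → x ≢ y → 1 ≤ dist G x y
  dist-≥-1 {x} {y} x≢y = search-≥ (λ j → reach G j x y) 0 n 1 no-step (inhabited x)
    where
    no-step : ∀ j → j ℕ.< 1 → ¬ T (reach G j x y)
    no-step zero _ r = x≢y (toWitness {a? = x ≟ y} r)
    no-step (suc _) (s≤s ()) _
    inhabited : Fin n → 1 ≤ n
    inhabited zero    = s≤s z≤n
    inhabited (suc _) = s≤s z≤n

  NonBacktracking : ∀ {x y} → Walk x y → Set
  NonBacktracking []                         = ⊤
  NonBacktracking (_ ∷ [])                   = ⊤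
  NonBacktracking {x} (_ ∷ _∷_ {y = z} f w) = x ≢ z × NonBacktracking (f ∷ w)

  NonBacktracking-tail : ∀ {x y z} {e : T (G x y)} (w : Walk y z) → NonBacktracking (e ∷ w) → NonBacktracking w
  NonBacktracking-tail []      _         = tt
  NonBacktracking-tail (_ ∷ _) (_ , nb) = nb

  prepend : ∀ {x y z} → T (G x y) → Walk y z → Walk x z
  prepend e [] = e ∷ []
  prepend {x} e (_∷_ {y = v} f w) with x ≟ v
  ... | yes refl = w
  ... | no _     = e ∷ f ∷ w

  removeBacktracks : ∀ {x y} → Walk x y → Walk x y
  removeBacktracks []      = []
  removeBacktracks (e ∷ w) = prepend e (removeBacktracks w)

  steps-prepend : ∀ {x y z} (e : T (G x y)) (w : Walk y z) → steps (prepend e w) ≤ suc (steps w)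
  steps-prepend e [] = ≤-refl
  steps-prepend {x} e (_∷_ {y = v} f w) with x ≟ v
  ... | yes refl = m≤n⇒m≤1+n (n≤1+n _)
  ... | no _     = ≤-refl

  prepend-NonBacktracking : ∀ {x y z} (e : T (G x y)) (w : Walk y z) → NonBacktracking w → NonBacktracking (prepend e w)
  prepend-NonBacktracking e [] _ = tt
  prepend-NonBacktracking {x} e (_∷_ {y = v} f w) nb with x ≟ v
  ... | yes refl = NonBacktracking-tail w nb
  ... | no x≢v   = x≢v , nb

  prepend-⊆ : ∀ {x y z} (e : T (G x y)) (w : Walk y z) → vertices (prepend e w) ⊆ vertices (e ∷ w)
  prepend-⊆ e [] = id
  prepend-⊆ {x} e (_∷_ {y = v} f w) with x ≟ v
  ... | yes refl = there ∘ there
  ... | no _     = id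

  steps-removeBacktracks : ∀ {x y} (w : Walk x y) → steps (removeBacktracks w) ≤ steps w
  steps-removeBacktracks []      = z≤n
  steps-removeBacktracks (e ∷ w) = ≤-trans (steps-prepend e (removeBacktracks w)) (s≤s (steps-removeBacktracks w))

  removeBacktracks-NonBacktracking : ∀ {x y} (w : Walk x y) → NonBacktracking (removeBacktracks w)
  removeBacktracks-NonBacktracking []      = tt
  removeBacktracks-NonBacktracking (e ∷ w) = prepend-NonBacktracking e (removeBacktracks w) (removeBacktracks-NonBacktracking w)

  removeBacktracks-⊆ : ∀ {x y} (w : Walk x y) → vertices (removeBacktracks w) ⊆ vertices w
  removeBacktracks-⊆ []      = id
  removeBacktracks-⊆ (e ∷ w) v∈ with prepend-⊆ e (removeBacktracks w) v∈
  ... | here v≡x = here v≡x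
  ... | there v∈w = there (removeBacktracks-⊆ w v∈w)

  prefix : ∀ {x y v} (w : Walk x y) → v ∈ vertices w → Walk x v
  prefix w         (here refl) = []
  prefix (e ∷ w)   (there v∈)  = e ∷ prefix w v∈

  prefix-⊆ : ∀ {x y v} (w : Walk x y) (v∈ : v ∈ vertices w) → vertices (prefix w v∈) ⊆ vertices w
  prefix-⊆ w       (here refl) (here refl) = here refl
  prefix-⊆ (e ∷ w) (there v∈)  (here refl) = here refl
  prefix-⊆ (e ∷ w) (there v∈)  (there u∈) = there (prefix-⊆ w v∈ u∈)

  prefix-unique : ∀ {x y v} (w : Walk x y) (v∈ : v ∈ vertices w) → Unique (vertices w) → Unique (vertices (prefix w v∈))
  prefix-unique w       (here refl) _           = [] ∷ []
  prefix-unique (e ∷ w) (there v∈)  (x∉w ∷ w!) = anti-mono (prefix-⊆ w v∈) x∉w ∷ prefix-unique w v∈ w!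

  length-vertices : ∀ {x y} (w : Walk x y) → length (vertices w) ≡ suc (steps w)
  length-vertices []      = refl
  length-vertices (_ ∷ w) = cong suc (length-vertices w)

  chain-snoc : ∀ {x y v} (w : Walk x y) → T (G y v) → Chain G (vertices w ++ [ v ])
  chain-snoc []      e = e , tt
  chain-snoc (f ∷ w) e = f , chain-snoc w e

  steps-≥-1 : ∀ {x y} → x ≢ y → (w : Walk x y) → 1 ≤ steps w
  steps-≥-1 x≢y []      = ⊥-elim (x≢y refl)
  steps-≥-1 x≢y (_ ∷ _) = s≤s z≤n

  ++ʷ-⊆ : ∀ {x y z v} (w : Walk x y) (u : Walk y z) → v ∈ vertices (w ++ʷ u) → v ∈ vertices w ⊎ v ∈ vertices u
  ++ʷ-⊆ []      u v∈         = inj₂ v∈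
  ++ʷ-⊆ (e ∷ w) u (here v≡x) = inj₁ (here v≡x)
  ++ʷ-⊆ (e ∷ w) u (there v∈) with ++ʷ-⊆ w u v∈
  ... | inj₁ v∈w = inj₁ (there v∈w)
  ... | inj₂ v∈u = inj₂ v∈u

  module Undirected (symmetric : ∀ x y → G x y ≡ G y x) where

    flip : ∀ {x y} → T (G x y) → T (G y x)
    flip {x} {y} = subst T (symmetric x y)

    reverse : ∀ {x y} → Walk x y → Walk y x
    reverse []      = []
    reverse (e ∷ w) = reverse w ++ʷ (flip e ∷ [])

    steps-reverse : ∀ {x y} (w : Walk x y) → steps (reverse w) ≡ steps w
    steps-reverse []      = refl
    steps-reverse (e ∷ w) = trans (steps-++ʷ (reverse w) (flip e ∷ [])) (trans (+-comm _ 1) (cong suc (steps-reverse w)))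

    reverse-⊆ : ∀ {x y} (w : Walk x y) → vertices (reverse w) ⊆ vertices w
    reverse-⊆ []      v∈ = v∈
    reverse-⊆ (e ∷ w) v∈ with ++ʷ-⊆ (reverse w) (flip e ∷ []) v∈
    ... | inj₁ v∈w                = there (reverse-⊆ w v∈w)
    ... | inj₂ (here v≡y)          = there (here v≡y)
    ... | inj₂ (there (here v≡x))  = here v≡x

  module Forest (simple : IsSimple G) (acyclic : Acyclic G) where

    open Undirected (proj₁ simple) public

    adjacent⇒≢ : ∀ {x y} → T (G x y) → x ≢ y
    adjacent⇒≢ {x} e refl = subst T (proj₂ simple x) e

    no-closing-edge : ∀ {x y} (w : Walk x y) → Unique (vertices w) → 2 ≤ steps w → ¬ T (G y x)
    no-closing-edge w w! 2≤w e = acyclic (vertices w)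
      (subst (3 ≤_) (sym (length-vertices w)) (s≤s 2≤w) , w! , chain-snoc w e)

    NonBacktracking⇒unique : ∀ {x y} (w : Walk x y) → NonBacktracking w → Unique (vertices w)
    NonBacktracking⇒unique []      _  = [] ∷ []
    NonBacktracking⇒unique {x} (e ∷ w) nb with DecMembership._∈?_ _≟_ x (vertices w)
    ... | no x∉w  = ¬Any⇒All¬ _ x∉w ∷ w!
      where w! = NonBacktracking⇒unique w (NonBacktracking-tail w nb)
    -- A repeated x closes a cycle, of length ≥ 3 as there are no loops and no backtracking.
    ... | yes x∈w = ⊥-elim (no-closing-edge (prefix w x∈w)
                              (prefix-unique w x∈w (NonBacktracking⇒unique w (NonBacktracking-tail w nb)))
                              (long-prefix w nb x∈w) e)
      where
      long-prefix : ∀ {z} (w : Walk _ z) → NonBacktracking (e ∷ w) → (x∈w : x ∈ vertices w) →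
                    2 ≤ steps (prefix w x∈w)
      long-prefix w           _        (here refl)         = ⊥-elim (adjacent⇒≢ e refl)
      long-prefix (f ∷ w)     (x≢ , _) (there (here refl)) = ⊥-elim (x≢ refl)
      long-prefix (f ∷ g ∷ w) _        (there (there _))   = s≤s (s≤s z≤n)

    NonBacktracking-steps-≤ : ∀ {x y} (P Q : Walk x y) → NonBacktracking P → NonBacktracking Q →
                              steps P ≤ steps Q
    NonBacktracking-steps-≤ [] Q _ _ = z≤n
    NonBacktracking-steps-≤ (e ∷ P) [] nbP _ with NonBacktracking⇒unique (e ∷ P) nbP
    ... | x∉P ∷ _ = ⊥-elim (All.lookup x∉P (last∈ P) refl)
    NonBacktracking-steps-≤ {x} (_∷_ {y = p} e P) (_∷_ {y = q} f Q) nbP nbQ with p ≟ q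
    ... | yes refl = s≤s (NonBacktracking-steps-≤ P Q (NonBacktracking-tail P nbP) (NonBacktracking-tail Q nbQ))
    -- Leaving x through different neighbours p and q would close a cycle x p ⋯ q x.
    ... | no p≢q   = ⊥-elim (no-closing-edge (e ∷ R) (¬Any⇒All¬ _ x∉R ∷ R!) (s≤s (steps-≥-1 p≢q R)) (flip f))
      where
      R : Walk p q
      R = removeBacktracks (P ++ʷ reverse Q)
      R! : Unique (vertices R)
      R! = NonBacktracking⇒unique R (removeBacktracks-NonBacktracking (P ++ʷ reverse Q))
      x∉R : x ∉ vertices R
      x∉R x∈R with NonBacktracking⇒unique (e ∷ P) nbP | NonBacktracking⇒unique (f ∷ Q) nbQ
      ... | x∉P ∷ _ | x∉Q ∷ _ with ++ʷ-⊆ P (reverse Q) (removeBacktracks-⊆ _ x∈R)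
      ...   | inj₁ x∈P = All.lookup x∉P x∈P refl
      ...   | inj₂ x∈Q = All.lookup x∉Q (reverse-⊆ Q x∈Q) refl

    dist-≥ : ∀ {x y} (P : Walk x y) → NonBacktracking P → steps P ≤ dist G x y
    dist-≥ {x} {y} P nb = search-≥ (λ j → reach G j x y) 0 n (steps P) no-shorter
      (≤-trans (n≤1+n _) (subst (_≤ n) (length-vertices P) (unique-length-≤ (NonBacktracking⇒unique P nb))))
      where
      no-shorter : ∀ j → j ℕ.< steps P → ¬ T (reach G j x y)
      no-shorter j j<P r with reach⇒walk j r
      ... | w , w≤j = <⇒≱ j<P (begin
        steps P                    ≤⟨ NonBacktracking-steps-≤ P (removeBacktracks w) nb (removeBacktracks-NonBacktracking w) ⟩
        steps (removeBacktracks w) ≤⟨ steps-removeBacktracks w ⟩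
        steps w                    ≤⟨ w≤j ⟩
        j                          ∎)
        where open ≤-Reasoning

    no-triangle : ∀ {x y z} → T (G x y) → T (G y z) → ¬ T (G z x)
    no-triangle xy yz zx
      with NonBacktracking⇒unique (xy ∷ yz ∷ zx ∷ []) (adjacent⇒≢ (flip zx) , adjacent⇒≢ (flip xy) , tt)
    ... | x∉ ∷ _ = All.lookup x∉ (there (there (here refl))) refl

module _ {n} (G : Graph n) where

  dist≤ecc : ∀ x y → dist G x y ≤ ecc G x
  dist≤ecc x y = maxL-≥ (dist G x) (∈-allFin y)

  ecc≤diam : ∀ x → ecc G x ≤ diam G
  ecc≤diam x = maxL-≥ (ecc G) (∈-allFin x)

  ecc-≤ : ∀ x {k} → (∀ y → dist G x y ≤ k) → ecc G x ≤ k
  ecc-≤ x = maxL-≤ (dist G x) (allFin n)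

-- Degrees and the products M

foldr-allFin : ∀ {A B : Set} {n} (_∙_ : A → B → B) e (f : Fin n → A) →
               foldr _∙_ e (map f (allFin n)) ≡ Vector.foldr _∙_ e f
foldr-allFin {n = n} _∙_ e f = trans (cong (foldr _∙_ e) (map-tabulate id f)) (foldr-tabulate f)
  where
  foldr-tabulate : ∀ {m} (g : Fin m → _) → foldr _∙_ e (tabulate g) ≡ Vector.foldr _∙_ e g
  foldr-tabulate {zero}  g = refl
  foldr-tabulate {suc m} g = cong (g zero ∙_) (foldr-tabulate (g ∘ suc))

module _ {n} (G : Graph n) where

  adj : Fin n → Vector ℕ n
  adj x y = ι (G x y)

  neighbourDeg : Fin n → Vector ℕ n
  neighbourDeg x y = if G x y then deg G y else 1

  deg-∑ : ∀ x → deg G x ≡ ∑ (adj x)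
  deg-∑ x = foldr-allFin _+_ 0 (adj x)

  M-∏ : ∀ x → M G x ≡ ∏ (neighbourDeg x)
  M-∏ x = foldr-allFin _*_ 1 (neighbourDeg x)

  deg-≥-length : ∀ {x ys} → Unique ys → All (T ∘ G x) ys → length ys ≤ deg G x
  deg-≥-length {x} ys! adjacent = subst (_ ≤_) (sym (deg-∑ x))
    (∑-≥-length (adj x) ys! (All.map (λ e → subst (1 ≤_) (sym (if-T e)) ≤-refl) adjacent))

  deg-≡-1 : ∀ {x y} → T (G x y) → (∀ z → T (G x z) → z ≡ y) → deg G x ≡ 1
  deg-≡-1 {x} {y} xy only-y = begin
    deg G x   ≡⟨ deg-∑ x ⟩
    ∑ (adj x) ≡⟨ ∑-single (adj x) y (λ z z≢y → if-¬T (z≢y ∘ only-y z)) ⟩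
    adj x y   ≡⟨ if-T xy ⟩
    1         ∎
    where open ≡-Reasoning

  M-≡ : ∀ {x y} → T (G x y) → (∀ z → T (G x z) → z ≢ y → deg G z ≡ 1) → M G x ≡ deg G y
  M-≡ {x} {y} xy others-leaves = begin
    M G x              ≡⟨ M-∏ x ⟩
    ∏ (neighbourDeg x) ≡⟨ ∏-single (neighbourDeg x) y trivial-factor ⟩
    neighbourDeg x y   ≡⟨ if-T xy ⟩
    deg G y            ∎
    where
    open ≡-Reasoning
    trivial-factor : ∀ z → z ≢ y → neighbourDeg x z ≡ 1
    trivial-factor z z≢y with T? (G x z)
    ... | yes xz = trans (if-T xz) (others-leaves z xz z≢y)
    ... | no ¬xz = if-¬T ¬xz

  other-neighbour : ∀ {x y} → 2 ≤ deg G x → T (G x y) → ∃[ z ] z ≢ y × T (G x z)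
  other-neighbour {x} {y} 2≤deg xy with any? (λ z → ¬? (z ≟ y) ×-dec T? (G x z))
  ... | yes found = found
  ... | no none = ⊥-elim (2≰1 (subst (2 ≤_) (deg-≡-1 xy only-y) 2≤deg))
    where
    only-y : ∀ z → T (G x z) → z ≡ y
    only-y z xz = decidable-stable (z ≟ y) (λ z≢y → none (z , z≢y , xz))
    2≰1 : ¬ 2 ≤ 1
    2≰1 (s≤s ())

  deg-≡-2 : ∀ {x y z} → y ≢ z → T (G x y) → T (G x z) → (∀ w → w ≢ y → w ≢ z → ¬ T (G x w)) →
            deg G x ≡ 2
  deg-≡-2 {x} {y} {z} y≢z xy xz only-y-z = begin
    deg G x           ≡⟨ deg-∑ x ⟩
    ∑ (adj x)         ≡⟨ ∑-pair (adj x) y z y≢z (λ w w≢y w≢z → if-¬T (only-y-z w w≢y w≢z)) ⟩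
    adj x y + adj x z ≡⟨ cong₂ _+_ (if-T xy) (if-T xz) ⟩
    2                 ∎
    where open ≡-Reasoning

  M-≡-pair : ∀ {x y z} → y ≢ z → T (G x y) → T (G x z) → (∀ w → w ≢ y → w ≢ z → ¬ T (G x w)) →
             M G x ≡ deg G y * deg G z
  M-≡-pair {x} {y} {z} y≢z xy xz only-y-z = begin
    M G x                               ≡⟨ M-∏ x ⟩
    ∏ (neighbourDeg x)                  ≡⟨ ∏-pair (neighbourDeg x) y z y≢z (λ w w≢y w≢z → if-¬T (only-y-z w w≢y w≢z)) ⟩
    neighbourDeg x y * neighbourDeg x z ≡⟨ cong₂ _*_ (if-T xy) (if-T xz) ⟩
    deg G y * deg G z                   ∎
    where open ≡-Reasoning

module _ {n} (H G : Graph n) where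

  deg-cong : ∀ {x} → (∀ z → H x z ≡ G x z) → deg H x ≡ deg G x
  deg-cong {x} H≡G = begin
    deg H x     ≡⟨ deg-∑ H x ⟩
    ∑ (adj H x) ≡⟨ ∑-cong (cong ι ∘ H≡G) ⟩
    ∑ (adj G x) ≡⟨ deg-∑ G x ⟨
    deg G x     ∎
    where open ≡-Reasoning

  deg-+1 : ∀ {x a} → (∀ z → z ≢ a → H x z ≡ G x z) → H x a ≡ true → G x a ≡ false → deg H x ≡ 1 + deg G x
  deg-+1 {x} {a} H≡G Hxa Gxa = begin
    deg H x                          ≡⟨ trans (deg-∑ H x) (∑-[]≔0 (adj H x) a) ⟩
    ι (H x a) + rest H               ≡⟨ cong₂ _+_ (cong ι Hxa) (∑-[]≔0-cong a (λ z z≢a → cong ι (H≡G z z≢a))) ⟩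
    1 + rest G                       ≡⟨ cong (λ p → 1 + (ι p + rest G)) Gxa ⟨
    1 + (ι (G x a) + rest G)         ≡⟨ cong suc (trans (deg-∑ G x) (∑-[]≔0 (adj G x) a)) ⟨
    1 + deg G x                      ∎
    where
    open ≡-Reasoning
    rest : Graph n → ℕ
    rest K = ∑ (adj K x [ a ]≔0)

  deg-+2 : ∀ {x a b} → a ≢ b → (∀ z → z ≢ a → z ≢ b → H x z ≡ G x z) →
           H x a ≡ true → H x b ≡ true → G x a ≡ false → G x b ≡ false → deg H x ≡ 2 + deg G x
  deg-+2 {x} {a} {b} a≢b H≡G Hxa Hxb Gxa Gxb = begin
    deg H x                                ≡⟨ trans (deg-∑ H x) (∑-[]≔0₂ (adj H x) a b a≢b) ⟩
    ι (H x a) + (ι (H x b) + rest H)       ≡⟨ cong₂ (λ p q → ι p + (ι q + rest H)) Hxa Hxb ⟩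
    2 + rest H                             ≡⟨ cong (2 +_) (∑-[]≔0₂-cong a b (λ z z≢a z≢b → cong ι (H≡G z z≢a z≢b))) ⟩
    2 + rest G                             ≡⟨ cong₂ (λ p q → 2 + (ι p + (ι q + rest G))) Gxa Gxb ⟨
    2 + (ι (G x a) + (ι (G x b) + rest G)) ≡⟨ cong (2 +_) (trans (deg-∑ G x) (∑-[]≔0₂ (adj G x) a b a≢b)) ⟨
    2 + deg G x                            ∎
    where
    open ≡-Reasoning
    rest : Graph n → ℕ
    rest K = ∑ (adj K x [ a ]≔0 [ b ]≔0)

module _ {n} (G : Graph n) where

  xiac-∑ℚ : xiac G ≡ ∑ℚ (λ v → frac (M G v) (ecc G v))
  xiac-∑ℚ = foldr-allFin ℚ._+_ 0ℚ (λ v → frac (M G v) (ecc G v))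

  xiac-≤ : (c : Vector ℕ n) → (∀ v → 12 ≤ c v * ecc G v) → xiac G ℚ.≤ frac (∑ (λ v → M G v * c v)) 12
  xiac-≤ c 12≤c*ecc = begin
    xiac G                                 ≡⟨ xiac-∑ℚ ⟩
    ∑ℚ (λ v → frac (M G v) (ecc G v))      ≤⟨ ∑ℚ-mono-≤ (λ v → frac-≤-rescale (M G v) (c v) _ 11 (12≤c*ecc v)) ⟩
    ∑ℚ (λ v → frac (M G v * c v) 12)       ≡⟨ ∑ℚ-frac (λ v → M G v * c v) 11 ⟩
    frac (∑ (λ v → M G v * c v)) 12        ∎
    where open ℚ.≤-Reasoning

  xiac-≥ : (c : Vector ℕ n) → (∀ v → 1 ≤ ecc G v) → (∀ v → c v * ecc G v ≤ 12) →
           frac (∑ (λ v → M G v * c v)) 12 ℚ.≤ xiac G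
  xiac-≥ c 1≤ecc c*ecc≤12 = begin
    frac (∑ (λ v → M G v * c v)) 12        ≡⟨ ∑ℚ-frac (λ v → M G v * c v) 11 ⟨
    ∑ℚ (λ v → frac (M G v * c v) 12)       ≤⟨ ∑ℚ-mono-≤ (λ v → frac-≥-rescale (M G v) (c v) _ 11 (1≤ecc v) (c*ecc≤12 v)) ⟩
    ∑ℚ (λ v → frac (M G v) (ecc G v))      ≡⟨ xiac-∑ℚ ⟨
    xiac G                                 ∎
    where open ℚ.≤-Reasoning

-- The transformed graph

isEdge-sym : ∀ {n} (p q x y : Fin n) → isEdge p q x y ≡ isEdge p q y x
isEdge-sym p q x y =
  trans (∨-comm (eqF x p ∧ eqF y q) _) (cong₂ _∨_ (∧-comm (eqF x q) _) (∧-comm (eqF x p) _))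

module Transform {n} (G : Graph n) (u vk a b : Fin n)
  (u≢vk : u ≢ vk) (u≢a : u ≢ a) (u≢b : u ≢ b) (vk≢a : vk ≢ a) (vk≢b : vk ≢ b) (a≢b : a ≢ b) where

  private
    vk≢u : vk ≢ u
    vk≢u = ≢-sym u≢vk
    a≢u : a ≢ u
    a≢u = ≢-sym u≢a
    b≢u : b ≢ u
    b≢u = ≢-sym u≢b
    a≢vk : a ≢ vk
    a≢vk = ≢-sym vk≢a
    b≢vk : b ≢ vk
    b≢vk = ≢-sym vk≢b
    b≢a : b ≢ a
    b≢a = ≢-sym a≢b

  -- Opaque, so that with-abstraction over vertex comparisons does not unfold transform.
  opaque
    G′ : Graph n
    G′ = transform G u vk a b

  opaque
    unfolding G′

    G′-≡ : G′ ≡ transform G u vk a b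
    G′-≡ = refl

    transform-sym : (∀ x y → G x y ≡ G y x) → ∀ x y → G′ x y ≡ G′ y x
    transform-sym G-sym x y
      rewrite isEdge-sym a vk x y | isEdge-sym b vk x y | isEdge-sym u a x y | isEdge-sym a b x y | G-sym x y = refl

    G′-other : ∀ {x} → x ≢ u → x ≢ vk → x ≢ a → x ≢ b → ∀ z → G′ x z ≡ G x z
    G′-other x≢u x≢vk x≢a x≢b z rewrite eqF-≢ x≢u | eqF-≢ x≢vk | eqF-≢ x≢a | eqF-≢ x≢b = refl

    G′-u : ∀ {z} → z ≢ a → G′ u z ≡ G u z
    G′-u z≢a
      rewrite eqF-≢ u≢vk | eqF-≢ u≢a | eqF-≢ u≢b | eqF-refl u | eqF-≢ z≢a = refl

    G′-ua : G′ u a ≡ true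
    G′-ua
      rewrite eqF-≢ u≢vk | eqF-≢ u≢a | eqF-≢ u≢b | eqF-refl u | eqF-refl a = refl

    G′-vk : ∀ {z} → z ≢ a → z ≢ b → G′ vk z ≡ G vk z
    G′-vk z≢a z≢b
      rewrite eqF-≢ vk≢u | eqF-≢ vk≢a | eqF-≢ vk≢b | eqF-refl vk | eqF-≢ z≢a | eqF-≢ z≢b = refl

    G′-vka : G′ vk a ≡ false
    G′-vka rewrite eqF-≢ vk≢a | eqF-refl vk | eqF-refl a = refl

    G′-vkb : G′ vk b ≡ false
    G′-vkb
      rewrite eqF-≢ vk≢a | eqF-≢ vk≢b | eqF-refl vk | eqF-refl b | eqF-≢ b≢a = refl

    G′-a : ∀ {z} → z ≢ u → z ≢ vk → z ≢ b → G′ a z ≡ G a z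
    G′-a z≢u z≢vk z≢b
      rewrite eqF-refl a | eqF-≢ a≢u | eqF-≢ a≢vk | eqF-≢ a≢b | eqF-≢ z≢u | eqF-≢ z≢vk | eqF-≢ z≢b = refl

    G′-au : G′ a u ≡ true
    G′-au
      rewrite eqF-refl a | eqF-refl u | eqF-≢ a≢u | eqF-≢ a≢vk | eqF-≢ a≢b | eqF-≢ u≢vk = refl

    G′-ab : G′ a b ≡ true
    G′-ab
      rewrite eqF-refl a | eqF-refl b | eqF-≢ a≢u | eqF-≢ a≢vk | eqF-≢ a≢b | eqF-≢ b≢vk | eqF-≢ b≢u = refl

    G′-avk : G′ a vk ≡ false
    G′-avk rewrite eqF-refl a | eqF-refl vk = refl

    G′-b : ∀ {z} → z ≢ a → z ≢ vk → G′ b z ≡ G b z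
    G′-b z≢a z≢vk
      rewrite eqF-refl b | eqF-≢ b≢a | eqF-≢ b≢vk | eqF-≢ b≢u | eqF-≢ z≢a | eqF-≢ z≢vk = refl

    G′-ba : G′ b a ≡ true
    G′-ba
      rewrite eqF-refl b | eqF-refl a | eqF-≢ b≢a | eqF-≢ b≢vk | eqF-≢ b≢u | eqF-≢ a≢vk = refl

    G′-bvk : G′ b vk ≡ false
    G′-bvk
      rewrite eqF-refl b | eqF-refl vk | eqF-≢ b≢a | eqF-≢ b≢vk = refl

-- Trees of diameter at most 4

-- 12 / ε(w) for the centre u, its neighbours and the remaining vertices of a tree of diameter 4.
centreWeight : ∀ {n} → Graph n → Fin n → Vector ℕ n
centreWeight H u w = if eqF w u then 6 else if H u w then 4 else 3

module _ {n} {H : Graph n} {u : Fin n} where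

  weight-centre : centreWeight H u u ≡ 6
  weight-centre rewrite eqF-refl u = refl

  weight-child : ∀ {w} → w ≢ u → T (H u w) → centreWeight H u w ≡ 4
  weight-child w≢u uw rewrite eqF-≢ w≢u = if-T uw

  weight-far : ∀ {w} → w ≢ u → ¬ T (H u w) → centreWeight H u w ≡ 3
  weight-far w≢u ¬uw rewrite eqF-≢ w≢u = if-¬T ¬uw

  weight-cases : ∀ (P : ℕ → Set) w →
                 (w ≡ u → P 6) → (w ≢ u → T (H u w) → P 4) → (w ≢ u → ¬ T (H u w) → P 3) → P (centreWeight H u w)
  weight-cases P w centre child far with w ≟ u
  ... | yes w≡u = centre w≡u
  ... | no w≢u with H u w
  ...   | true  = child w≢u tt
  ...   | false = far w≢u λ ()

module Diameter≤4 {n} (G : Graph n) (tree : IsTree G) (diam≤4 : diam G ≤ 4)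
  (u s₁ s₂ : Fin n) (s₁≢s₂ : s₁ ≢ s₂) (us₁ : T (G u s₁)) (us₂ : T (G u s₂))
  (2≤deg-s₁ : 2 ≤ deg G s₁) (2≤deg-s₂ : 2 ≤ deg G s₂) where

  open Walks G
  open Forest (proj₁ tree) (proj₂ (proj₂ tree)) public

  record Branch (v : Fin n) : Set where
    field
      {s s′} : Fin n
      s≢v    : s ≢ v
      us     : T (G u s)
      ss′    : T (G s s′)
      s′≢u   : s′ ≢ u

  branch-through : ∀ {v s} → s ≢ v → T (G u s) → 2 ≤ deg G s → Branch v
  branch-through s≢v us 2≤deg with other-neighbour G 2≤deg (flip us)
  ... | _ , s′≢u , ss′ = record { s≢v = s≢v ; us = us ; ss′ = ss′ ; s′≢u = s′≢u }

  branch : ∀ v → Branch v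
  branch v with s₁ ≟ v
  ... | no s₁≢v  = branch-through s₁≢v us₁ 2≤deg-s₁
  ... | yes refl = branch-through (≢-sym s₁≢s₂) us₂ 2≤deg-s₂

  nonBacktracking-ecc : ∀ {x y} (w : Walk x y) → NonBacktracking w → steps w ≤ ecc G x
  nonBacktracking-ecc {x} {y} w nb = ≤-trans (dist-≥ w nb) (dist≤ecc G x y)

  -- Prolonged backwards through another branch of u, such a walk would be a path of length 5.
  no-walk-of-depth-3 : ∀ {w₁ w₂ w₃} → T (G u w₁) → T (G w₁ w₂) → T (G w₂ w₃) → u ≢ w₂ → w₁ ≢ w₃ → ⊥
  no-walk-of-depth-3 {w₁} {w₃ = w₃} uw₁ w₁w₂ w₂w₃ u≢w₂ w₁≢w₃ =
    5≰4 (≤-trans (nonBacktracking-ecc walk (s′≢u , s≢v , u≢w₂ , w₁≢w₃ , tt)) (≤-trans (ecc≤diam G s′) diam≤4))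
    where
    open Branch (branch w₁)
    walk : Walk s′ w₃
    walk = flip ss′ ∷ flip us ∷ uw₁ ∷ w₁w₂ ∷ w₂w₃ ∷ []
    5≰4 : ¬ 5 ≤ 4
    5≰4 (s≤s (s≤s (s≤s (s≤s ()))))

  data Position (w : Fin n) : Set where
    centre     : w ≡ u → Position w
    child      : T (G u w) → Position w
    grandchild : ∀ {v} → T (G u v) → T (G v w) → w ≢ u → Position w

  position-step : ∀ {x y} → Position x → T (G x y) → Position y
  position-step (centre refl) uy = child uy
  position-step {y = y} (child ux) xy with y ≟ u
  ... | yes y≡u = centre y≡u
  ... | no y≢u  = grandchild ux xy y≢u
  position-step {y = y} (grandchild {v} uv vx x≢u) xy with y ≟ v
  ... | yes refl = child uv
  ... | no y≢v   = ⊥-elim (no-walk-of-depth-3 uv vx xy (≢-sym x≢u) (≢-sym y≢v))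

  position : ∀ w → Position w
  position w = along (proj₁ (reach⇒walk k u⇝w)) (centre refl)
    where
    k : ℕ
    k = proj₁ (proj₁ (proj₂ tree) u w)
    u⇝w : T (reach G k u w)
    u⇝w = proj₂ (proj₁ (proj₂ tree) u w)
    along : ∀ {x y} → Walk x y → Position x → Position y
    along []      p = p
    along (e ∷ w) p = along w (position-step p e)

  grandchild-leaf : ∀ {v w} → T (G u v) → T (G v w) → w ≢ u → ∀ z → T (G w z) → z ≡ v
  grandchild-leaf {v} uv vw w≢u z wz with z ≟ v
  ... | yes z≡v = z≡v
  ... | no z≢v  = ⊥-elim (no-walk-of-depth-3 uv vw wz (≢-sym w≢u) (≢-sym z≢v))

  grandchild-not-child : ∀ {v w} → T (G u v) → T (G v w) → ¬ T (G u w)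
  grandchild-not-child uv vw uw = no-triangle uv vw (flip uw)

  deg-grandchild : ∀ {v w} → T (G u v) → T (G v w) → w ≢ u → deg G w ≡ 1
  deg-grandchild uv vw w≢u = deg-≡-1 G (flip vw) (grandchild-leaf uv vw w≢u)

  M-grandchild : ∀ {v w} → T (G u v) → T (G v w) → w ≢ u → M G w ≡ deg G v
  M-grandchild uv vw w≢u = M-≡ G (flip vw) (λ z wz z≢v → ⊥-elim (z≢v (grandchild-leaf uv vw w≢u z wz)))

  M-child : ∀ {v} → T (G u v) → M G v ≡ deg G u
  M-child uv = M-≡ G (flip uv) (λ z vz z≢u → deg-grandchild uv vz z≢u)

  ecc-centre : 2 ≤ ecc G u
  ecc-centre = nonBacktracking-ecc (us ∷ ss′ ∷ []) (≢-sym s′≢u , tt)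
    where open Branch (branch u)

  ecc-child : ∀ {v} → T (G u v) → 3 ≤ ecc G v
  ecc-child {v} uv = nonBacktracking-ecc (flip uv ∷ us ∷ ss′ ∷ []) (≢-sym s≢v , ≢-sym s′≢u , tt)
    where open Branch (branch v)

  ecc-grandchild : ∀ {v w} → T (G u v) → T (G v w) → w ≢ u → 4 ≤ ecc G w
  ecc-grandchild {v} uv vw w≢u =
    nonBacktracking-ecc (flip vw ∷ flip uv ∷ us ∷ ss′ ∷ []) (w≢u , ≢-sym s≢v , ≢-sym s′≢u , tt)
    where open Branch (branch v)

  ecc-far : ∀ {w} → w ≢ u → ¬ T (G u w) → 4 ≤ ecc G w
  ecc-far {w} w≢u ¬uw with position w
  ... | centre w≡u           = ⊥-elim (w≢u w≡u)
  ... | child uw             = ⊥-elim (¬uw uw)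
  ... | grandchild uv vw w≢u = ecc-grandchild uv vw w≢u

  12≤weight*ecc : ∀ w → 12 ≤ centreWeight G u w * ecc G w
  12≤weight*ecc w = weight-cases {H = G} (λ c → 12 ≤ c * ecc G w) w
    (λ { refl → *-monoʳ-≤ 6 ecc-centre })
    (λ _ uw → *-monoʳ-≤ 4 (ecc-child uw))
    (λ w≢u ¬uw → *-monoʳ-≤ 3 (ecc-far w≢u ¬uw))

module PendantPathMove {n} (G : Graph n) (tree : IsTree G) (diam≤4 : diam G ≤ 4)
  (u p q r : Fin n) (p≢q : p ≢ q) (p≢r : p ≢ r) (q≢r : q ≢ r)
  (up : T (G u p)) (uq : T (G u q)) (ur : T (G u r)) (2≤deg-p : 2 ≤ deg G p) (2≤deg-q : 2 ≤ deg G q)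
  (vk : Fin n) (uvk : T (G u vk)) (4≤deg-vk : 4 ≤ deg G vk)
  (a b : Fin n) (a≢b : a ≢ b) (vka : T (G vk a)) (vkb : T (G vk b)) (deg-a : deg G a ≡ 1) (deg-b : deg G b ≡ 1) where

  open Diameter≤4 G tree diam≤4 u p q p≢q up uq 2≤deg-p 2≤deg-q public

  3≤deg-u : 3 ≤ deg G u
  3≤deg-u = deg-≥-length G ((p≢q ∷ p≢r ∷ []) ∷ (q≢r ∷ []) ∷ [] ∷ []) (up ∷ uq ∷ ur ∷ [])

  leaf≢u : ∀ {x} → deg G x ≡ 1 → x ≢ u
  leaf≢u deg-x refl with s≤s () ← subst (3 ≤_) deg-x 3≤deg-u

  a≢u : a ≢ u
  a≢u = leaf≢u deg-a

  b≢u : b ≢ u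
  b≢u = leaf≢u deg-b

  open Transform G u vk a b (adjacent⇒≢ uvk) (≢-sym a≢u) (≢-sym b≢u) (adjacent⇒≢ vka) (adjacent⇒≢ vkb) a≢b public

  child≢a : ∀ {v} → T (G u v) → v ≢ a
  child≢a uv refl = grandchild-not-child uvk vka uv

  child≢b : ∀ {v} → T (G u v) → v ≢ b
  child≢b uv refl = grandchild-not-child uvk vkb uv

  grandchild≢vk : ∀ {v w} → T (G u v) → T (G v w) → w ≢ vk
  grandchild≢vk uv vw refl = grandchild-not-child uv vw uvk

  a-only-vk : ∀ {z} → z ≢ vk → ¬ T (G a z)
  a-only-vk z≢vk az = z≢vk (grandchild-leaf uvk vka a≢u _ az)

  b-only-vk : ∀ {z} → z ≢ vk → ¬ T (G b z)
  b-only-vk z≢vk bz = z≢vk (grandchild-leaf uvk vkb b≢u _ bz)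

  G′-child≢vk : ∀ {v} → T (G u v) → v ≢ vk → ∀ z → G′ v z ≡ G v z
  G′-child≢vk uv v≢vk = G′-other (≢-sym (adjacent⇒≢ uv)) v≢vk (child≢a uv) (child≢b uv)

  G′-child : ∀ {v z} → T (G u v) → z ≢ a → z ≢ b → G′ v z ≡ G v z
  G′-child {v} uv z≢a z≢b with v ≟ vk
  ... | yes refl = G′-vk z≢a z≢b
  ... | no v≢vk  = G′-child≢vk uv v≢vk _

  G′-child-a : ∀ {v} → T (G u v) → ¬ T (G′ v a)
  G′-child-a {v} uv with v ≟ vk
  ... | yes refl = ≡false⇒¬T G′-vka
  ... | no v≢vk  = a-only-vk v≢vk ∘ flip ∘ subst T (G′-child≢vk uv v≢vk a)

  G′-child-b : ∀ {v} → T (G u v) → ¬ T (G′ v b)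
  G′-child-b {v} uv with v ≟ vk
  ... | yes refl = ≡false⇒¬T G′-vkb
  ... | no v≢vk  = b-only-vk v≢vk ∘ flip ∘ subst T (G′-child≢vk uv v≢vk b)

  G′-grandchild : ∀ {v w} → T (G u v) → T (G v w) → w ≢ u → w ≢ a → w ≢ b → ∀ z → G′ w z ≡ G w z
  G′-grandchild uv vw w≢u w≢a w≢b = G′-other w≢u (grandchild≢vk uv vw) w≢a w≢b

  a′-only-u-b : ∀ z → z ≢ u → z ≢ b → ¬ T (G′ a z)
  a′-only-u-b z z≢u z≢b with z ≟ vk
  ... | yes refl = ≡false⇒¬T G′-avk
  ... | no z≢vk  = a-only-vk z≢vk ∘ subst T (G′-a z≢u z≢vk z≢b)

  b′-only-a : ∀ z → T (G′ b z) → z ≡ a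
  b′-only-a z bz with z ≟ a | z ≟ vk
  ... | yes z≡a | _        = z≡a
  ... | no _    | yes refl = ⊥-elim (≡false⇒¬T G′-bvk bz)
  ... | no z≢a  | no z≢vk  = ⊥-elim (b-only-vk z≢vk (subst T (G′-b z≢a z≢vk) bz))

  deg′-untouched : ∀ {x} → x ≢ u → x ≢ vk → x ≢ a → x ≢ b → deg G′ x ≡ deg G x
  deg′-untouched x≢u x≢vk x≢a x≢b = deg-cong G′ G (G′-other x≢u x≢vk x≢a x≢b)

  deg′-u : deg G′ u ≡ suc (deg G u)
  deg′-u = deg-+1 G′ G (λ z → G′-u) G′-ua (¬T⇒≡false (grandchild-not-child uvk vka))

  deg-vk : deg G vk ≡ 2 + deg G′ vk
  deg-vk = deg-+2 G G′ a≢b (λ z z≢a z≢b → sym (G′-vk z≢a z≢b)) (T⇒≡true vka) (T⇒≡true vkb) G′-vka G′-vkb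

  deg′-a : deg G′ a ≡ 2
  deg′-a = deg-≡-2 G′ (≢-sym b≢u) (≡true⇒T G′-au) (≡true⇒T G′-ab) a′-only-u-b

  deg′-b : deg G′ b ≡ 1
  deg′-b = deg-≡-1 G′ (≡true⇒T G′-ba) b′-only-a

  deg′-grandchild : ∀ {v w} → T (G u v) → T (G v w) → w ≢ u → w ≢ a → w ≢ b → deg G′ w ≡ 1
  deg′-grandchild uv vw w≢u w≢a w≢b = trans (deg-cong G′ G (G′-grandchild uv vw w≢u w≢a w≢b)) (deg-grandchild uv vw w≢u)

  M′-child : ∀ {v} → T (G u v) → M G′ v ≡ suc (deg G u)
  M′-child {v} uv = trans (M-≡ G′ vu′ others-leaves) deg′-u
    where
    vu′ : T (G′ v u)
    vu′ = subst T (sym (G′-child uv (≢-sym a≢u) (≢-sym b≢u))) (flip uv)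
    others-leaves : ∀ z → T (G′ v z) → z ≢ u → deg G′ z ≡ 1
    others-leaves z vz z≢u with z ≟ a | z ≟ b
    ... | yes refl | _        = ⊥-elim (G′-child-a uv vz)
    ... | no _     | yes refl = ⊥-elim (G′-child-b uv vz)
    ... | no z≢a   | no z≢b   = deg′-grandchild uv (subst T (G′-child uv z≢a z≢b) vz) z≢u z≢a z≢b

  M′-a : M G′ a ≡ suc (deg G u) * 1
  M′-a = trans (M-≡-pair G′ (≢-sym b≢u) (≡true⇒T G′-au) (≡true⇒T G′-ab) a′-only-u-b) (cong₂ _*_ deg′-u deg′-b)

  M′-b : M G′ b ≡ 2
  M′-b = trans (M-≡ G′ (≡true⇒T G′-ba) (λ z bz z≢a → ⊥-elim (z≢a (b′-only-a z bz)))) deg′-a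

  M′-grandchild : ∀ {v w} → T (G u v) → T (G v w) → w ≢ u → w ≢ a → w ≢ b → M G′ w ≡ deg G′ v
  M′-grandchild uv vw w≢u w≢a w≢b = M-≡ G′ (subst T (sym (G′-grandchild uv vw w≢u w≢a w≢b _)) (flip vw))
    (λ z wz z≢v → ⊥-elim (z≢v (grandchild-leaf uv vw w≢u z (subst T (G′-grandchild uv vw w≢u w≢a w≢b z) wz))))

  -- The factor common to M(u) in G and in G′; vk contributes deg vk resp. deg′ vk, and a contributes 1 resp. 2.
  P : ℕ
  P = ∏ (neighbourDeg G u [ vk ]≔1 [ a ]≔1)

  M-u : M G u ≡ deg G vk * (1 * P)
  M-u = trans (M-∏ G u) (trans (∏-[]≔1₂ (neighbourDeg G u) vk a (adjacent⇒≢ vka))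
    (cong₂ (λ x y → x * (y * P)) (if-T uvk) (if-¬T (grandchild-not-child uvk vka))))

  M′-u : M G′ u ≡ deg G′ vk * (2 * P)
  M′-u = trans (M-∏ G′ u) (trans (∏-[]≔1₂ (neighbourDeg G′ u) vk a (adjacent⇒≢ vka))
    (cong₃ (λ x y z → x * (y * z)) (if-T (subst T (sym (G′-u (adjacent⇒≢ vka))) uvk)) (trans (if-T (≡true⇒T G′-ua)) deg′-a)
           (∏-[]≔1₂-cong vk a same-factor)))
    where
    cong₃ : ∀ (f : ℕ → ℕ → ℕ → ℕ) {x x′ y y′ z z′} → x ≡ x′ → y ≡ y′ → z ≡ z′ → f x y z ≡ f x′ y′ z′
    cong₃ f refl refl refl = refl
    same-factor : ∀ z → z ≢ vk → z ≢ a → neighbourDeg G′ u z ≡ neighbourDeg G u z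
    same-factor z z≢vk z≢a with T? (G u z)
    ... | yes uz = begin
      neighbourDeg G′ u z ≡⟨ if-T (subst T (sym (G′-u z≢a)) uz) ⟩
      deg G′ z      ≡⟨ deg′-untouched (≢-sym (adjacent⇒≢ uz)) z≢vk z≢a (child≢b uz) ⟩
      deg G z       ≡⟨ if-T uz ⟨
      neighbourDeg G u z  ∎
      where open ≡-Reasoning
    ... | no ¬uz = trans (if-¬T (¬uz ∘ subst T (G′-u z≢a))) (sym (if-¬T ¬uz))

  2≤P : 2 ≤ P
  2≤P = ≤-trans 2≤deg-s (subst (_≤ P) factor-at-s (∏-≥-factor _ s ([]≔1-≥1 a ([]≔1-≥1 vk positive))))
    where
    open Branch (branch vk)
    2≤deg-s : 2 ≤ deg G s
    2≤deg-s = deg-≥-length G ((≢-sym s′≢u ∷ []) ∷ [] ∷ []) (flip us ∷ ss′ ∷ [])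
    positive : ∀ j → 1 ≤ neighbourDeg G u j
    positive j with T? (G u j)
    ... | yes uj = subst (1 ≤_) (sym (if-T uj)) (deg-≥-length G ([] ∷ []) (flip uj ∷ []))
    ... | no ¬uj = subst (1 ≤_) (sym (if-¬T ¬uj)) ≤-refl
    factor-at-s : (neighbourDeg G u [ vk ]≔1 [ a ]≔1) s ≡ deg G s
    factor-at-s = trans (updateAt-minimal s a _ (child≢a us)) (trans (updateAt-minimal s vk _ s≢v) (if-T us))

  module W′ = Walks G′
  module U′ = W′.Undirected (transform-sym (proj₁ (proj₁ tree)))

  from-u′ : ∀ z → Σ[ w ∈ W′.Walk u z ] W′.steps w ≤ 2
  from-u′ z with position z
  ... | centre refl = W′.[] , z≤n
  ... | child uz    = (subst T (sym (G′-u (child≢a uz))) uz W′.∷ W′.[]) , s≤s z≤n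
  ... | grandchild {v} uv vz z≢u with z ≟ a | z ≟ b
  ...   | yes refl | _        = (≡true⇒T G′-ua W′.∷ W′.[]) , s≤s z≤n
  ...   | no _     | yes refl = (≡true⇒T G′-ua W′.∷ ≡true⇒T G′-ab W′.∷ W′.[]) , ≤-refl
  ...   | no z≢a   | no z≢b   = (uv′ W′.∷ vz′ W′.∷ W′.[]) , ≤-refl
    where
    uv′ : T (G′ u v)
    uv′ = subst T (sym (G′-u (child≢a uv))) uv
    vz′ : T (G′ v z)
    vz′ = subst T (sym (G′-child uv z≢a z≢b)) vz

  ecc′-centre : ecc G′ u ≤ 2
  ecc′-centre = ecc-≤ G′ u (λ z → ≤-trans (W′.dist-≤ (proj₁ (from-u′ z))) (proj₂ (from-u′ z)))

  ecc′-child : ∀ {x} → T (G′ u x) → ecc G′ x ≤ 3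
  ecc′-child ux = ecc-≤ G′ _ (λ z →
    ≤-trans (W′.dist-≤ (U′.flip ux W′.∷ proj₁ (from-u′ z))) (s≤s (proj₂ (from-u′ z))))

  ecc′-≤-4 : ∀ x → ecc G′ x ≤ 4
  ecc′-≤-4 x = ecc-≤ G′ x (λ z → ≤-trans (W′.dist-≤ (via-u z)) (steps-via-u z))
    where
    u→ : ∀ z → W′.Walk u z
    u→ z = proj₁ (from-u′ z)
    via-u : ∀ z → W′.Walk x z
    via-u z = U′.reverse (u→ x) W′.++ʷ u→ z
    steps-via-u : ∀ z → W′.steps (via-u z) ≤ 4
    steps-via-u z = begin
      W′.steps (via-u z)                             ≡⟨ W′.steps-++ʷ (U′.reverse (u→ x)) (u→ z) ⟩
      W′.steps (U′.reverse (u→ x)) + W′.steps (u→ z) ≡⟨ cong (_+ W′.steps (u→ z)) (U′.steps-reverse (u→ x)) ⟩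
      W′.steps (u→ x) + W′.steps (u→ z)              ≤⟨ +-mono-≤ (proj₂ (from-u′ x)) (proj₂ (from-u′ z)) ⟩
      4                                              ∎
      where open ≤-Reasoning

  1≤ecc′ : ∀ x → 1 ≤ ecc G′ x
  1≤ecc′ x with x ≟ u
  ... | yes refl = ≤-trans (W′.dist-≥-1 (≢-sym a≢u)) (dist≤ecc G′ x a)
  ... | no x≢u   = ≤-trans (W′.dist-≥-1 x≢u) (dist≤ecc G′ x u)

  weight′*ecc′≤12 : ∀ w → centreWeight G′ u w * ecc G′ w ≤ 12
  weight′*ecc′≤12 w = weight-cases {H = G′} (λ c → c * ecc G′ w ≤ 12) w
    (λ { refl → *-monoʳ-≤ 6 ecc′-centre })
    (λ _ uw → *-monoʳ-≤ 4 (ecc′-child uw))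
    (λ _ _ → *-monoʳ-≤ 3 (ecc′-≤-4 w))

  d d′ k : ℕ
  d  = deg G vk
  d′ = deg G′ vk
  k  = deg G u

  -- A and B bound 12 times the contributions to ξ^{ac}. The corrections X and Y make A + Y = B + X hold
  -- at every vertex and have explicit sums, with ∑ Y − ∑ X = 4 + 8(k − 3) + 6(P − 2)(d − 4).
  A B X Y : Vector ℕ n
  A w = M G w * centreWeight G u w
  B w = M G′ w * centreWeight G′ u w
  X w = 6 * adj G vk w + δ a (3 * d) w + δ b (3 * d) w + δ u (6 * M G u) w
  Y w = 4 * adj G u w + δ a (4 * k + 10) w + δ b 12 w + δ u (6 * M G′ u + 6) w

  data Role : Fin n → Set where
    is-u  : Role u
    is-a  : Role a
    is-b  : Role b
    other : ∀ {w} → w ≢ u → w ≢ a → w ≢ b → Role w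

  role : ∀ w → Role w
  role w with w ≟ u | w ≟ a | w ≟ b
  ... | yes refl | _        | _        = is-u
  ... | no _     | yes refl | _        = is-a
  ... | no _     | no _     | yes refl = is-b
  ... | no w≢u   | no w≢a   | no w≢b   = other w≢u w≢a w≢b

  X-≡ : ∀ {w α β γ ε} → adj G vk w ≡ α → δ a (3 * d) w ≡ β → δ b (3 * d) w ≡ γ → δ u (6 * M G u) w ≡ ε →
        X w ≡ 6 * α + β + γ + ε
  X-≡ α β γ ε = cong₂ _+_ (cong₂ _+_ (cong₂ _+_ (cong (6 *_) α) β) γ) ε

  Y-≡ : ∀ {w α β γ ε} → adj G u w ≡ α → δ a (4 * k + 10) w ≡ β → δ b 12 w ≡ γ → δ u (6 * M G′ u + 6) w ≡ ε →
        Y w ≡ 4 * α + β + γ + ε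
  Y-≡ α β γ ε = cong₂ _+_ (cong₂ _+_ (cong₂ _+_ (cong (4 *_) α) β) γ) ε

  balance-by : ∀ {w α β ξ η} → A w ≡ α → B w ≡ β → X w ≡ ξ → Y w ≡ η → α + η ≡ β + ξ → A w + Y w ≡ B w + X w
  balance-by A≡ B≡ X≡ Y≡ eq = trans (cong₂ _+_ A≡ Y≡) (trans eq (sym (cong₂ _+_ B≡ X≡)))

  balance : ∀ w → A w + Y w ≡ B w + X w
  balance w with role w
  ... | is-u = balance-by
    (cong (M G u *_) (weight-centre {H = G} {u = u}))
    (cong (M G′ u *_) (weight-centre {H = G′} {u = u}))
    (X-≡ (if-T (flip uvk)) (δ-other (≢-sym a≢u)) (δ-other (≢-sym b≢u)) (δ-same u))
    (Y-≡ (if-¬T (λ uu → adjacent⇒≢ uu refl)) (δ-other (≢-sym a≢u)) (δ-other (≢-sym b≢u)) (δ-same u))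
    (arith (M G u) (M G′ u))
    where
    arith : ∀ m m′ → m * 6 + (4 * 0 + 0 + 0 + (6 * m′ + 6)) ≡ m′ * 6 + (6 * 1 + 0 + 0 + 6 * m)
    arith = solve-∀
  ... | is-a = balance-by
    (cong₂ _*_ (M-grandchild uvk vka a≢u) (weight-far {H = G} a≢u (grandchild-not-child uvk vka)))
    (cong₂ _*_ M′-a (weight-child {H = G′} a≢u (≡true⇒T G′-ua)))
    (X-≡ (if-T vka) (δ-same a) (δ-other a≢b) (δ-other a≢u))
    (Y-≡ (if-¬T (grandchild-not-child uvk vka)) (δ-same a) (δ-other a≢b) (δ-other a≢u))
    (arith d k)
    where
    arith : ∀ d k → d * 3 + (4 * 0 + (4 * k + 10) + 0 + 0) ≡ suc k * 1 * 4 + (6 * 1 + 3 * d + 0 + 0)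
    arith = solve-∀
  ... | is-b = balance-by
    (cong₂ _*_ (M-grandchild uvk vkb b≢u) (weight-far {H = G} b≢u (grandchild-not-child uvk vkb)))
    (cong₂ _*_ M′-b (weight-far {H = G′} b≢u (grandchild-not-child uvk vkb ∘ subst T (G′-u (≢-sym a≢b)))))
    (X-≡ (if-T vkb) (δ-other (≢-sym a≢b)) (δ-same b) (δ-other b≢u))
    (Y-≡ (if-¬T (grandchild-not-child uvk vkb)) (δ-other (≢-sym a≢b)) (δ-same b) (δ-other b≢u))
    (arith d)
    where
    arith : ∀ d → d * 3 + (4 * 0 + 0 + 12 + 0) ≡ 2 * 3 + (6 * 1 + 0 + 3 * d + 0)
    arith = solve-∀
  ... | other w≢u w≢a w≢b with position w
  ...   | centre w≡u = ⊥-elim (w≢u w≡u)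
  ...   | child uw = balance-by
    (cong₂ _*_ (M-child uw) (weight-child {H = G} w≢u uw))
    (cong₂ _*_ (M′-child uw) (weight-child {H = G′} w≢u (subst T (sym (G′-u w≢a)) uw)))
    (X-≡ (if-¬T (λ vkw → no-triangle uvk vkw (flip uw))) (δ-other w≢a) (δ-other w≢b) (δ-other w≢u))
    (Y-≡ (if-T uw) (δ-other w≢a) (δ-other w≢b) (δ-other w≢u))
    (arith k)
    where
    arith : ∀ k → k * 4 + (4 * 1 + 0 + 0 + 0) ≡ suc k * 4 + (6 * 0 + 0 + 0 + 0)
    arith = solve-∀
  ...   | grandchild {v} uv vw _ with v ≟ vk
  ...     | yes refl = balance-by
    (cong₂ _*_ (trans (M-grandchild uv vw w≢u) deg-vk) (weight-far {H = G} w≢u (grandchild-not-child uv vw)))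
    (cong₂ _*_ (M′-grandchild uv vw w≢u w≢a w≢b) (weight-far {H = G′} w≢u (grandchild-not-child uv vw ∘ subst T (G′-u w≢a))))
    (X-≡ (if-T vw) (δ-other w≢a) (δ-other w≢b) (δ-other w≢u))
    (Y-≡ (if-¬T (grandchild-not-child uv vw)) (δ-other w≢a) (δ-other w≢b) (δ-other w≢u))
    (arith (deg G′ vk))
    where
    arith : ∀ d′ → (2 + d′) * 3 + (4 * 0 + 0 + 0 + 0) ≡ d′ * 3 + (6 * 1 + 0 + 0 + 0)
    arith = solve-∀
  ...     | no v≢vk = balance-by
    (cong₂ _*_ (M-grandchild uv vw w≢u) (weight-far {H = G} w≢u (grandchild-not-child uv vw)))
    (cong₂ _*_ (trans (M′-grandchild uv vw w≢u w≢a w≢b) (deg-cong G′ G (G′-child≢vk uv v≢vk)))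
               (weight-far {H = G′} w≢u (grandchild-not-child uv vw ∘ subst T (G′-u w≢a))))
    (X-≡ (if-¬T (λ vkw → v≢vk (sym (grandchild-leaf uv vw w≢u vk (flip vkw))))) (δ-other w≢a) (δ-other w≢b) (δ-other w≢u))
    (Y-≡ (if-¬T (grandchild-not-child uv vw)) (δ-other w≢a) (δ-other w≢b) (δ-other w≢u))
    (arith (deg G v))
    where
    arith : ∀ m → m * 3 + (4 * 0 + 0 + 0 + 0) ≡ m * 3 + (6 * 0 + 0 + 0 + 0)
    arith = solve-∀

  ∑X : ∑ X ≡ 6 * (2 + d′) + 3 * (2 + d′) + 3 * (2 + d′) + 6 * ((2 + d′) * (1 * P))
  ∑X = begin
    ∑ X                                           ≡⟨ ∑-+δ₃ 6 (adj G vk) a (3 * d) b (3 * d) u (6 * M G u) ⟩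
    6 * ∑ (adj G vk) + 3 * d + 3 * d + 6 * M G u  ≡⟨ cong₂ (λ s m → 6 * s + 3 * d + 3 * d + 6 * m) (deg-∑ G vk) (sym M-u) ⟨
    6 * d + 3 * d + 3 * d + 6 * (d * (1 * P))     ≡⟨ cong (λ e → 6 * e + 3 * e + 3 * e + 6 * (e * (1 * P))) deg-vk ⟩
    6 * (2 + d′) + 3 * (2 + d′) + 3 * (2 + d′) + 6 * ((2 + d′) * (1 * P)) ∎
    where open ≡-Reasoning

  ∑Y : ∑ Y ≡ 4 * k + (4 * k + 10) + 12 + (6 * (d′ * (2 * P)) + 6)
  ∑Y = begin
    ∑ Y                                                   ≡⟨ ∑-+δ₃ 4 (adj G u) a (4 * k + 10) b 12 u (6 * M G′ u + 6) ⟩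
    4 * ∑ (adj G u) + (4 * k + 10) + 12 + (6 * M G′ u + 6)
      ≡⟨ cong₂ (λ s m → 4 * s + (4 * k + 10) + 12 + (6 * m + 6)) (deg-∑ G u) (sym M′-u) ⟨
    4 * k + (4 * k + 10) + 12 + (6 * (d′ * (2 * P)) + 6)   ∎
    where open ≡-Reasoning

  ∑X<∑Y : ∑ X ℕ.< ∑ Y
  ∑X<∑Y = subst₂ ℕ._<_ (sym ∑X) (sym ∑Y) (key-inequality d′ P k 2≤d′ 2≤P 3≤deg-u)
    where
    2≤d′ : 2 ≤ d′
    2≤d′ = ℕ.+-cancelˡ-≤ 2 2 d′ (subst (4 ≤_) deg-vk 4≤deg-vk)
    key-inequality : ∀ d′ P k → 2 ≤ d′ → 2 ≤ P → 3 ≤ k →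
      6 * (2 + d′) + 3 * (2 + d′) + 3 * (2 + d′) + 6 * ((2 + d′) * (1 * P)) ℕ.<
      4 * k + (4 * k + 10) + 12 + (6 * (d′ * (2 * P)) + 6)
    key-inequality d′ P k 2≤d′ 2≤P 3≤k with m≤n⇒∃[o]m+o≡n 2≤d′ | m≤n⇒∃[o]m+o≡n 2≤P | m≤n⇒∃[o]m+o≡n 3≤k
    ... | t , refl | x , refl | y , refl = subst (lhs ℕ.<_) (difference t x y) (m<m+n lhs (s≤s z≤n))
      where
      lhs : ℕ
      lhs = 6 * (4 + t) + 3 * (4 + t) + 3 * (4 + t) + 6 * ((4 + t) * (1 * (2 + x)))
      difference : ∀ t x y →
        6 * (4 + t) + 3 * (4 + t) + 3 * (4 + t) + 6 * ((4 + t) * (1 * (2 + x))) + (4 + 8 * y + 6 * x * t) ≡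
        4 * (3 + y) + (4 * (3 + y) + 10) + 12 + (6 * ((2 + t) * (2 * (2 + x))) + 6)
      difference = solve-∀

  ∑A<∑B : ∑ A ℕ.< ∑ B
  ∑A<∑B = ∑-compensate A B Y X balance ∑X<∑Y

lemma7 : (n : ℕ) (G : Graph n) → IsTree G → diam G ≡ 4 →
    (u : Fin n) → (∀ w → ecc G u ≤ ecc G w) →
    (p q r : Fin n) → p ≢ q → p ≢ r → q ≢ r →
    T (G u p) → T (G u q) → T (G u r) →
    2 ≤ deg G p → 2 ≤ deg G q → 2 ≤ deg G r →
    (v1 vk : Fin n) → T (G u v1) → T (G u vk) →
    (∀ w → T (G u w) → deg G v1 ≤ deg G w) →
    (∀ w → T (G u w) → deg G w ≤ deg G vk) →
    deg G vk ≤ deg G v1 + 1 → 4 ≤ deg G vk →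
    (a b : Fin n) → a ≢ b → T (G vk a) → T (G vk b) → deg G a ≡ 1 → deg G b ≡ 1 →
    xiac G < xiac (transform G u vk a b)
lemma7 n G tree diam≡4 u _ p q r p≢q p≢r q≢r up uq ur 2≤deg-p 2≤deg-q _ _ vk _ uvk _ _ _ 4≤deg-vk a b a≢b vka vkb deg-a deg-b =
  begin-strict
    xiac G                       ≤⟨ xiac-≤ G (centreWeight G u) 12≤weight*ecc ⟩
    frac (∑ A) 12                <⟨ frac-< (∑ A) (∑ B) 11 ∑A<∑B ⟩
    frac (∑ B) 12                ≤⟨ xiac-≥ G′ (centreWeight G′ u) 1≤ecc′ weight′*ecc′≤12 ⟩
    xiac G′                      ≡⟨ cong xiac G′-≡ ⟩
    xiac (transform G u vk a b)  ∎
  where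
  open ℚ.≤-Reasoning
  open PendantPathMove G tree (ℕ.≤-reflexive diam≡4) u p q r p≢q p≢r q≢r up uq ur 2≤deg-p 2≤deg-q
                       vk uvk 4≤deg-vk a b a≢b vka vkb deg-a deg-b
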